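{- Let $G=([m]\cup[n],E)$ be a domination graph in which every right vertex $j\in[n]$ has degree exactly one, and let $(d_1,d_2,\ldots,d_\Delta)$ be its degree distribution. If there exists a $G$-dominating injective map $\varphi:\{0,1\}^m\to\mathcal{B}(n,w)$, then $$m \le \min_{t_1,\ldots,t_\Delta}\left\{(t_1+t_2+\cdots+t_\Delta)+\log_2\sum_{j=0}^{w}\binom{n-t_1-2t_2-\cdots-\Delta t_\Delta}{j}\right\},$$ where the minimum is over all nonnegative integers $t_1,\ldots,t_\Delta$ with $t_i\le d_i$ for $i=1,\ldots,\Delta$.
   Context: For $y \in \{0,1\}^n$, $\mathrm{wt}(y)$ is the number of nonzero coordinates, and $\mathcal{B}(n,w)=\{y\in\{0,1\}^n : \mathrm{wt}(y)\le w\}$. A domination graph is a bipartite graph $G=([m]\cup[n],E)$ with left vertex set $[m]$ and right vertex set $[n]$ having no isolated right vertices. An injective map $\varphi:\{0,1\}^m\to\mathcal{B}(n,w)$ is $G$-dominating if for every $x\in\{0,1\}^m$ and every edge $(i,j)\in E$: $x_i=0$ implies that the $j$-th coordinate of $\varphi(x)$ is $0$. For a domination graph whose right vertices all have degree one, $\Delta$ is the maximum degree of a left vertex and the degree distribution is $(d_1,\ldots,d_\Delta)$, where $d_i$ is the number of left vertices of degree $i$; thus $\sum_i d_i = m$ (when no left vertex is isolated) and $\sum_i i\,d_i=n$. -}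

module Defs where

open import Data.Nat using (ℕ; zero; suc; _+_; _*_; _∸_; _^_; _≤_; _⊔_)
open import Data.Nat.Properties using (_≟_)
open import Data.Nat.Combinatorics using (_C_)
open import Data.Bool using (Bool; true; false)
open import Data.Fin using (Fin)
open import Data.Vec using (Vec; tabulate; lookup)
open import Relation.Nullary.Decidable using (⌊_⌋)
open import Relation.Binary.PropositionalEquality using (_≡_)

countTrue : ∀ {k} → Vec Bool k → ℕ
countTrue Vec.[] = 0
countTrue (true Vec.∷ v) = suc (countTrue v)
countTrue (false Vec.∷ v) = countTrue v

-- Hamming weight of y ∈ {0,1}^n  (true = 1)
wt : ∀ {n} → Vec Bool n → ℕ
wt = countTrue

BipGraph : ℕ → ℕ → Set
BipGraph m n = Fin m → Fin n → Bool

degL : ∀ {m n} → BipGraph m n → Fin m → ℕ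
degL E i = countTrue (tabulate (E i))

degR : ∀ {m n} → BipGraph m n → Fin n → ℕ
degR E j = countTrue (tabulate (λ i → E i j))

-- every right vertex has degree exactly one (in particular no isolated right vertex,
-- so G is a domination graph)
RightDegOne : ∀ {m n} → BipGraph m n → Set
RightDegOne {n = n} E = (j : Fin n) → degR E j ≡ 1

maxVec : ∀ {k} → Vec ℕ k → ℕ
maxVec Vec.[] = 0
maxVec (x Vec.∷ v) = x ⊔ maxVec v

maxDegL : ∀ {m n} → BipGraph m n → ℕ
maxDegL E = maxVec (tabulate (degL E))

degDist : ∀ {m n} → BipGraph m n → ℕ → ℕ
degDist E k = countTrue (tabulate (λ i → ⌊ degL E i ≟ k ⌋))

-- G-dominating injective map φ : {0,1}^m → B(n,w)
-- (maps into {0,1}^n with the weight bound recorded separately)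
IsDominatingInjection : ∀ {m n} → BipGraph m n → ℕ → (Vec Bool m → Vec Bool n) → Set
IsDominatingInjection {m} {n} E w φ =
  ((x y : Vec Bool m) → φ x ≡ φ y → x ≡ y)
  × ((x : Vec Bool m) → wt (φ x) ≤ w)
  × ((x : Vec Bool m) (i : Fin m) (j : Fin n) →
       E i j ≡ true → lookup x i ≡ false → lookup (φ x) j ≡ false)
  where open import Data.Product using (_×_)

sum1 : ℕ → (ℕ → ℕ) → ℕ
sum1 zero f = 0
sum1 (suc K) f = sum1 K f + f (suc K)

sum0 : ℕ → (ℕ → ℕ) → ℕ
sum0 zero f = f 0
sum0 (suc w) f = sum0 w f + f (suc w)

ballSize : ℕ → ℕ → ℕ
ballSize N w = sum0 w (λ j → N C j)

module Submission where

-- Choose a set S of left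
-- vertices containing exactly t k vertices of degree k for each 1 ≤ k ≤ Δ.
-- Then |S| = Σ t k and S has total degree s = Σ k · t k; since every right
-- vertex has only one neighbour, the neighbourhood N(S) has at least s
-- elements.  Restrict φ to the 2 ^ (m - |S|) inputs vanishing on S: by
-- domination their images vanish on N(S), they have weight ≤ w and they are
-- pairwise distinct, so there are at most |B(n - |N(S)|, w)| ≤ |B(n - s, w)|
-- of them.  Multiplying by 2 ^ |S| gives 2 ^ m ≤ 2 ^ |S| · |B(n - s, w)|.

open import Defs
open import Data.Nat using (ℕ; zero; suc; _+_; _*_; _∸_; _^_; _≤_; _≤′_; ≤′-refl; ≤′-step; z≤n; s≤s)
open import Data.Nat.Properties
open import Data.Nat.Combinatorics using (_C_; nCk+nC[k+1]≡[n+1]C[k+1])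
open import Algebra.Properties.Semiring.Sum +-*-semiring
  using (sum; sum-cong-≗; ∑-distrib-+; ∑-comm; *-distribʳ-sum; sum-replicate-zero)
open import Data.Bool using (Bool; true; false; not; _∧_; _∨_)
open import Data.Bool.Properties using (∧-conicalˡ; ∧-conicalʳ)
open import Data.Fin using (Fin; zero; suc)
open import Data.Vec using (Vec; []; _∷_; lookup; tabulate)
open import Data.Vec.Properties using (∷-injectiveʳ)
open import Data.List using (List; map; _++_; length; [_])
open import Data.List.Properties using (length-map; length-++; length-removeAt′)
open import Data.List.Membership.Propositional using (_∈_; _─_)
open import Data.List.Membership.Propositional.Properties using (∈-map⁺; ∈-map⁻; ∈-++⁺ˡ; ∈-++⁺ʳ; ∈-++⁻)
open import Data.List.Relation.Unary.Any using (here; there; index)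
open import Data.List.Relation.Unary.All as All using ([])
open import Data.List.Relation.Unary.AllPairs using ([]; _∷_)
open import Data.List.Relation.Unary.Unique.Propositional using (Unique)
import Data.List.Relation.Unary.Unique.Propositional.Properties as Unique
open import Data.Product using (Σ; Σ-syntax; _×_; _,_)
open import Data.Sum using (inj₁; inj₂)
open import Data.Empty using (⊥; ⊥-elim)
open import Function using (_∘_)
open import Relation.Nullary using (yes)
open import Relation.Nullary.Decidable using (⌊_⌋)
open import Relation.Binary.PropositionalEquality hiding ([_])

-- A subset of Fin k is a Boolean predicate; χ is its indicator value.
χ : Bool → ℕ
χ true  = 1
χ false = 0

size : ∀ {k} → (Fin k → Bool) → ℕ
size A = sum (λ i → χ (A i))

sumOver : ∀ {k} → (Fin k → Bool) → (Fin k → ℕ) → ℕ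
sumOver A f = sum (λ i → χ (A i) * f i)

countTrue-tabulate : ∀ {k} (A : Fin k → Bool) → countTrue (tabulate A) ≡ size A
countTrue-tabulate {zero}  A = refl
countTrue-tabulate {suc k} A with A zero
... | true  = cong suc (countTrue-tabulate (A ∘ suc))
... | false = countTrue-tabulate (A ∘ suc)

sum-mono : ∀ {k} {f g : Fin k → ℕ} → (∀ i → f i ≤ g i) → sum f ≤ sum g
sum-mono {zero}  f≤g = z≤n
sum-mono {suc k} f≤g = +-mono-≤ (f≤g zero) (sum-mono (f≤g ∘ suc))

size-complement : ∀ {k} (A : Fin k → Bool) → size (not ∘ A) + size A ≡ k
size-complement {k} A = begin
  size (not ∘ A) + size A              ≡⟨ ∑-distrib-+ (χ ∘ not ∘ A) (χ ∘ A) ⟨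
  sum (λ i → χ (not (A i)) + χ (A i))  ≡⟨ sum-cong-≗ (χ-not ∘ A) ⟩
  sum {k} (λ _ → 1)                    ≡⟨ sum-ones k ⟩
  k                                    ∎
  where
  open ≡-Reasoning
  χ-not : ∀ a → χ (not a) + χ a ≡ 1
  χ-not true  = refl
  χ-not false = refl
  sum-ones : ∀ k → sum {k} (λ _ → 1) ≡ k
  sum-ones zero    = refl
  sum-ones (suc k) = cong suc (sum-ones k)

module _ {k} (A B : Fin k → Bool) (disjoint : ∀ i → A i ≡ true → B i ≡ true → ⊥) where

  χ-∨ : ∀ i → χ (A i ∨ B i) ≡ χ (A i) + χ (B i)
  χ-∨ i with A i | B i | disjoint i
  ... | true  | true  | d = ⊥-elim (d refl refl)
  ... | true  | false | _ = refl
  ... | false | _     | _ = refl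

  size-∪ : size (λ i → A i ∨ B i) ≡ size A + size B
  size-∪ = trans (sum-cong-≗ χ-∨) (∑-distrib-+ (χ ∘ A) (χ ∘ B))

  sumOver-∪ : ∀ f → sumOver (λ i → A i ∨ B i) f ≡ sumOver A f + sumOver B f
  sumOver-∪ f = trans (sum-cong-≗ (λ i → trans (cong (_* f i) (χ-∨ i))
                                                (*-distribʳ-+ (f i) (χ (A i)) (χ (B i)))))
                      (∑-distrib-+ (λ i → χ (A i) * f i) (λ i → χ (B i) * f i))

sumOver-const : ∀ {k} (A : Fin k → Bool) (f : Fin k → ℕ) c →
                (∀ i → A i ≡ true → f i ≡ c) → sumOver A f ≡ size A * c
sumOver-const A f c const = trans (sum-cong-≗ on-A) (sym (*-distribʳ-sum c (χ ∘ A)))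
  where
  on-A : ∀ i → χ (A i) * f i ≡ χ (A i) * c
  on-A i with A i in eq
  ... | true  = cong (1 *_) (const i eq)
  ... | false = refl

-- Pascal's rule, summed: |B(c+1, w+1)| = |B(c, w+1)| + |B(c, w)|.
ballSize-suc : ∀ c w → ballSize (suc c) (suc w) ≡ ballSize c (suc w) + ballSize c w
ballSize-suc c zero = begin
  1 + suc c C 1        ≡⟨ cong (1 +_) (nCk+nC[k+1]≡[n+1]C[k+1] c 0) ⟨
  1 + (1 + c C 1)      ≡⟨ +-comm 1 (1 + c C 1) ⟩
  (1 + c C 1) + 1      ∎
  where open ≡-Reasoning
ballSize-suc c (suc w) = begin
  ballSize (suc c) (suc w) + suc c C suc (suc w)
    ≡⟨ cong₂ _+_ (ballSize-suc c w) (sym (nCk+nC[k+1]≡[n+1]C[k+1] c (suc w))) ⟩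
  (B₁ + B₀) + (c C suc w + c C suc (suc w))
    ≡⟨ regroup B₁ B₀ (c C suc w) (c C suc (suc w)) ⟩
  (B₁ + c C suc (suc w)) + (B₀ + c C suc w) ∎
  where
  open ≡-Reasoning
  open import Data.Nat.Tactic.RingSolver using (solve-∀)
  B₁ = ballSize c (suc w)
  B₀ = ballSize c w
  regroup : ∀ a b x y → (a + b) + (x + y) ≡ (a + y) + (b + x)
  regroup = solve-∀

ballSize-zero : ∀ w → ballSize 0 w ≡ 1
ballSize-zero zero    = refl
ballSize-zero (suc w) = trans (+-identityʳ (ballSize 0 w)) (ballSize-zero w)

ballSize-step : ∀ c w → ballSize c w ≤ ballSize (suc c) w
ballSize-step c zero    = ≤-refl
ballSize-step c (suc w) = subst (ballSize c (suc w) ≤_) (sym (ballSize-suc c w))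
                                (m≤m+n (ballSize c (suc w)) (ballSize c w))

ballSize-mono : ∀ w {c c′} → c ≤ c′ → ballSize c w ≤ ballSize c′ w
ballSize-mono w c≤c′ = mono′ (≤⇒≤′ c≤c′)
  where
  mono′ : ∀ {c c′} → c ≤′ c′ → ballSize c w ≤ ballSize c′ w
  mono′ ≤′-refl         = ≤-refl
  mono′ (≤′-step c≤c′) = ≤-trans (mono′ c≤c′) (ballSize-step _ w)

-- A duplicate-free list whose elements all occur in ys is no longer than ys:
-- match its head against an occurrence in ys, remove it, and recurse.
unique-⊆-length : ∀ {A : Set} {xs ys : List A} → Unique xs →
                  (∀ {z} → z ∈ xs → z ∈ ys) → length xs ≤ length ys
unique-⊆-length {xs = List.[]}     _        _     = z≤n
unique-⊆-length {xs = x List.∷ xs} {ys} (x∉xs ∷ u) xs⊆ys =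
  subst (suc (length xs) ≤_) (sym (length-removeAt′ ys (index x∈ys)))
    (s≤s (unique-⊆-length u (λ z∈xs → ∈-─ x∈ys (xs⊆ys (there z∈xs)) (All.lookup x∉xs z∈xs))))
  where
  x∈ys = xs⊆ys (here refl)
  ∈-─ : ∀ {x z} {ys : List _} (p : x ∈ ys) → z ∈ ys → x ≢ z → z ∈ ys ─ p
  ∈-─ (here refl) (here refl) x≢z = ⊥-elim (x≢z refl)
  ∈-─ (here _)    (there q)   _   = q
  ∈-─ (there p)   (here q)    _   = here q
  ∈-─ (there p)   (there q)   x≢z = there (∈-─ p q x≢z)

VanishesOn : ∀ {k} → (Fin k → Bool) → Vec Bool k → Set
VanishesOn S x = ∀ i → S i ≡ true → lookup x i ≡ false

prepend : ∀ {m} → (forced : Bool) → List (Vec Bool m) → List (Vec Bool (suc m))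
prepend true  xs = map (false ∷_) xs
prepend false xs = map (false ∷_) xs ++ map (true ∷_) xs

cube : ∀ {m} → (Fin m → Bool) → List (Vec Bool m)
cube {zero}  S = [ [] ]
cube {suc m} S = prepend (S zero) (cube (S ∘ suc))

cube-unique : ∀ {m} (S : Fin m → Bool) → Unique (cube S)
cube-unique {zero}  S = [] ∷ []
cube-unique {suc m} S with S zero
... | true  = Unique.map⁺ ∷-injectiveʳ (cube-unique (S ∘ suc))
... | false = Unique.++⁺ (Unique.map⁺ ∷-injectiveʳ (cube-unique (S ∘ suc)))
                         (Unique.map⁺ ∷-injectiveʳ (cube-unique (S ∘ suc))) heads-differ
  where
  heads-differ : ∀ {v} → v ∈ map (false ∷_) (cube (S ∘ suc)) × v ∈ map (true ∷_) (cube (S ∘ suc)) → ⊥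
  heads-differ (p , q) with ∈-map⁻ (false ∷_) p | ∈-map⁻ (true ∷_) q
  ... | _ , _ , refl | _ , _ , ()

cube-vanishes : ∀ {m} (S : Fin m → Bool) {x} → x ∈ cube S → VanishesOn S x
cube-vanishes {suc m} S {b ∷ x} p i Si with S zero in eq | i
... | true | zero with ∈-map⁻ (false ∷_) p
...   | _ , _ , refl = refl
cube-vanishes {suc m} S {b ∷ x} p i Si | true | suc i′ with ∈-map⁻ (false ∷_) p
...   | _ , q , refl = cube-vanishes (S ∘ suc) q i′ Si
cube-vanishes {suc m} S {b ∷ x} p i Si | false | zero with () ← trans (sym eq) Si
cube-vanishes {suc m} S {b ∷ x} p i Si | false | suc i′
  with ∈-++⁻ (map (false ∷_) (cube (S ∘ suc))) p
... | inj₁ p′ with ∈-map⁻ (false ∷_) p′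
...   | _ , q , refl = cube-vanishes (S ∘ suc) q i′ Si
cube-vanishes {suc m} S {b ∷ x} p i Si | false | suc i′ | inj₂ p′ with ∈-map⁻ (true ∷_) p′
...   | _ , q , refl = cube-vanishes (S ∘ suc) q i′ Si

-- There are 2 ^ (m - |S|) such words, stated without subtraction.
cube-length : ∀ {m} (S : Fin m → Bool) → 2 ^ size S * length (cube S) ≡ 2 ^ m
cube-length {zero}  S = refl
cube-length {suc m} S with S zero | cube-length (S ∘ suc)
... | true  | ih = begin
  2 ^ suc s * length (map (false ∷_) xs) ≡⟨ cong (2 ^ suc s *_) (length-map (false ∷_) xs) ⟩
  2 * 2 ^ s * length xs                  ≡⟨ *-assoc 2 (2 ^ s) (length xs) ⟩
  2 * (2 ^ s * length xs)                ≡⟨ cong (2 *_) ih ⟩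
  2 ^ suc m                              ∎
  where
  open ≡-Reasoning
  s  = size (S ∘ suc)
  xs = cube (S ∘ suc)
... | false | ih = begin
  2 ^ s * length (map (false ∷_) xs ++ map (true ∷_) xs)
    ≡⟨ cong (2 ^ s *_) (length-++ (map (false ∷_) xs)) ⟩
  2 ^ s * (length (map (false ∷_) xs) + length (map (true ∷_) xs))
    ≡⟨ cong₂ (λ a b → 2 ^ s * (a + b)) (length-map (false ∷_) xs) (length-map (true ∷_) xs) ⟩
  2 ^ s * (length xs + length xs)
    ≡⟨ *-distribˡ-+ (2 ^ s) (length xs) (length xs) ⟩
  2 ^ s * length xs + 2 ^ s * length xs
    ≡⟨ cong₂ _+_ ih (trans ih (sym (+-identityʳ (2 ^ m)))) ⟩
  2 ^ suc m ∎
  where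
  open ≡-Reasoning
  s  = size (S ∘ suc)
  xs = cube (S ∘ suc)

prependWeighted : ∀ {n} → (forced : Bool) → (w : ℕ) →
                  (ℕ → List (Vec Bool n)) → List (Vec Bool (suc n))
prependWeighted true  w       ys = map (false ∷_) (ys w)
prependWeighted false zero    ys = map (false ∷_) (ys zero)
prependWeighted false (suc w) ys = map (false ∷_) (ys (suc w)) ++ map (true ∷_) (ys w)

ball : ∀ {n} → (Fin n → Bool) → ℕ → List (Vec Bool n)
ball {zero}  N w = [ [] ]
ball {suc n} N w = prependWeighted (N zero) w (ball (N ∘ suc))

ball-complete : ∀ {n} (N : Fin n → Bool) w (y : Vec Bool n) →
                VanishesOn N y → wt y ≤ w → y ∈ ball N w
ball-complete {zero}  N w [] _ _ = here refl
ball-complete {suc n} N w (b ∷ y) y|N wt≤w with N zero in eq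
... | true with y|N zero eq
...   | refl = ∈-map⁺ (false ∷_) (ball-complete (N ∘ suc) w y (y|N ∘ suc) wt≤w)
ball-complete {suc n} N zero (false ∷ y) y|N wt≤w | false =
  ∈-map⁺ (false ∷_) (ball-complete (N ∘ suc) zero y (y|N ∘ suc) wt≤w)
ball-complete {suc n} N (suc w) (false ∷ y) y|N wt≤w | false =
  ∈-++⁺ˡ (∈-map⁺ (false ∷_) (ball-complete (N ∘ suc) (suc w) y (y|N ∘ suc) wt≤w))
ball-complete {suc n} N (suc w) (true ∷ y) y|N (s≤s wt≤w) | false =
  ∈-++⁺ʳ (map (false ∷_) (ball (N ∘ suc) (suc w)))
         (∈-map⁺ (true ∷_) (ball-complete (N ∘ suc) w y (y|N ∘ suc) wt≤w))

ball-length : ∀ {n} (N : Fin n → Bool) w → length (ball N w) ≡ ballSize (size (not ∘ N)) w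
ball-length {zero}  N w = sym (ballSize-zero w)
ball-length {suc n} N w with N zero
... | true = trans (length-map (false ∷_) (ball (N ∘ suc) w)) (ball-length (N ∘ suc) w)
ball-length {suc n} N zero | false =
  trans (length-map (false ∷_) (ball (N ∘ suc) zero)) (ball-length (N ∘ suc) zero)
ball-length {suc n} N (suc w) | false = begin
  length (map (false ∷_) (ys (suc w)) ++ map (true ∷_) (ys w))
    ≡⟨ length-++ (map (false ∷_) (ys (suc w))) ⟩
  length (map (false ∷_) (ys (suc w))) + length (map (true ∷_) (ys w))
    ≡⟨ cong₂ _+_ (trans (length-map (false ∷_) (ys (suc w))) (ball-length (N ∘ suc) (suc w)))
                 (trans (length-map (true ∷_) (ys w)) (ball-length (N ∘ suc) w)) ⟩
  ballSize c (suc w) + ballSize c w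
    ≡⟨ ballSize-suc c w ⟨
  ballSize (suc c) (suc w) ∎
  where
  open ≡-Reasoning
  ys = ball (N ∘ suc)
  c  = size (not ∘ N ∘ suc)

restriction-bound : ∀ {m n} (S : Fin m → Bool) (N : Fin n → Bool) w
  (φ : Vec Bool m → Vec Bool n) → (∀ x y → φ x ≡ φ y → x ≡ y) →
  (∀ x → VanishesOn S x → VanishesOn N (φ x)) → (∀ x → wt (φ x) ≤ w) →
  2 ^ m ≤ 2 ^ size S * ballSize (size (not ∘ N)) w
restriction-bound {m} S N w φ injective vanishing weight = begin
  2 ^ m                                      ≡⟨ cube-length S ⟨
  2 ^ size S * length (cube S)               ≡⟨ cong (2 ^ size S *_) (length-map φ (cube S)) ⟨
  2 ^ size S * length (map φ (cube S))       ≤⟨ *-monoʳ-≤ (2 ^ size S) images≤ball ⟩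
  2 ^ size S * length (ball N w)             ≡⟨ cong (2 ^ size S *_) (ball-length N w) ⟩
  2 ^ size S * ballSize (size (not ∘ N)) w   ∎
  where
  open ≤-Reasoning
  images⊆ball : ∀ {y} → y ∈ map φ (cube S) → y ∈ ball N w
  images⊆ball p with ∈-map⁻ φ p
  ... | x , x∈cube , refl = ball-complete N w (φ x) (vanishing x (cube-vanishes S x∈cube)) (weight x)
  images≤ball : length (map φ (cube S)) ≤ length (ball N w)
  images≤ball = unique-⊆-length (Unique.map⁺ (injective _ _) (cube-unique S)) images⊆ball

level : ∀ {m} → (Fin m → ℕ) → ℕ → Fin m → Bool
level deg k i = ⌊ deg i ≟ k ⌋

level-sound : ∀ {m} (deg : Fin m → ℕ) k i → level deg k i ≡ true → deg i ≡ k
level-sound deg k i h with deg i ≟ k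
... | yes deg≡k = deg≡k

choose-subset : ∀ {m} (A : Fin m → Bool) t → t ≤ size A →
  Σ[ B ∈ (Fin m → Bool) ] ((∀ i → B i ≡ true → A i ≡ true) × size B ≡ t)
choose-subset {m}     A zero    _ = (λ _ → false) , (λ _ ()) , sum-replicate-zero m
choose-subset {zero}  A (suc t) ()
choose-subset {suc m} A (suc t) t<|A| with A zero in eq
... | true with choose-subset (A ∘ suc) t (≤-pred t<|A|)
...   | B , B⊆A , |B| = (λ { zero → true ; (suc i) → B i })
                      , (λ { zero _ → eq ; (suc i) → B⊆A i }) , cong suc |B|
choose-subset {suc m} A (suc t) t<|A| | false with choose-subset (A ∘ suc) (suc t) t<|A|
...   | B , B⊆A , |B| = (λ { zero → false ; (suc i) → B i })
                      , (λ { zero () ; (suc i) → B⊆A i }) , |B|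

-- Degree-k vertices are added
-- in the step K = k, disjointly from the earlier ones (which have degree < k).
degree-layers : ∀ {m} (deg : Fin m → ℕ) (t : ℕ → ℕ) K →
  (∀ k → 1 ≤ k → k ≤ K → t k ≤ size (level deg k)) →
  Σ[ S ∈ (Fin m → Bool) ] ((∀ i → S i ≡ true → deg i ≤ K)
    × size S ≡ sum1 K t × sumOver S deg ≡ sum1 K (λ k → k * t k))
degree-layers {m} deg t zero _ =
  (λ _ → false) , (λ _ ()) , sum-replicate-zero m , sum-replicate-zero m
degree-layers deg t (suc K) t≤d
  with degree-layers deg t K (λ k 1≤k k≤K → t≤d k 1≤k (m≤n⇒m≤1+n k≤K))
     | choose-subset (level deg (suc K)) (t (suc K)) (t≤d (suc K) (s≤s z≤n) ≤-refl)
... | S , S≤K , |S| , degS | L , L⊆level , |L| =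
  (λ i → S i ∨ L i) , union≤1+K , size-union , degree-union
  where
  L-deg : ∀ i → L i ≡ true → deg i ≡ suc K
  L-deg i Li = level-sound deg (suc K) i (L⊆level i Li)
  disjoint : ∀ i → S i ≡ true → L i ≡ true → ⊥
  disjoint i Si Li = <-irrefl (L-deg i Li) (s≤s (S≤K i Si))
  union≤1+K : ∀ i → (S i ∨ L i) ≡ true → deg i ≤ suc K
  union≤1+K i h with S i in eS | L i in eL
  ... | true  | _    = m≤n⇒m≤1+n (S≤K i eS)
  ... | false | true = ≤-reflexive (L-deg i eL)
  size-union : size (λ i → S i ∨ L i) ≡ sum1 K t + t (suc K)
  size-union = trans (size-∪ S L disjoint) (cong₂ _+_ |S| |L|)
  degree-union : sumOver (λ i → S i ∨ L i) deg ≡ sum1 K (λ k → k * t k) + suc K * t (suc K)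
  degree-union = trans (sumOver-∪ S L disjoint deg)
    (cong₂ _+_ degS (trans (sumOver-const L deg (suc K) L-deg)
                           (trans (cong (_* suc K) |L|) (*-comm (t (suc K)) (suc K)))))

some : ∀ {k} → (Fin k → Bool) → Bool
some {zero}  g = false
some {suc k} g = g zero ∨ some (g ∘ suc)

some-witness : ∀ {k} (g : Fin k → Bool) → some g ≡ true → Σ[ i ∈ Fin k ] g i ≡ true
some-witness {suc k} g h with g zero in eq
... | true  = zero , eq
... | false with some-witness (g ∘ suc) h
...   | i , gi = suc i , gi

size≤1⇒≤some : ∀ {k} (g : Fin k → Bool) → size g ≤ 1 → size g ≤ χ (some g)
size≤1⇒≤some {zero}  g _ = z≤n
size≤1⇒≤some {suc k} g h with g zero
... | true  = h
... | false = size≤1⇒≤some (g ∘ suc) h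

neighbourhood : ∀ {m n} → BipGraph m n → (Fin m → Bool) → Fin n → Bool
neighbourhood E S j = some (λ i → S i ∧ E i j)

neighbourhood-vanishes : ∀ {m n} (E : BipGraph m n) (S : Fin m → Bool)
  (x : Vec Bool m) (y : Vec Bool n) →
  (∀ i j → E i j ≡ true → lookup x i ≡ false → lookup y j ≡ false) →
  VanishesOn S x → VanishesOn (neighbourhood E S) y
neighbourhood-vanishes E S x y dominated x|S j Nj with some-witness (λ i → S i ∧ E i j) Nj
... | i , SE = dominated i j (∧-conicalʳ (S i) (E i j) SE) (x|S i (∧-conicalˡ (S i) (E i j) SE))

-- When right degrees are ≤ 1, the edges leaving S reach distinct right
-- vertices, so |N(S)| is at least the total degree of S (double counting).
neighbourhood-size : ∀ {m n} (E : BipGraph m n) (S : Fin m → Bool) →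
  (∀ j → degR E j ≤ 1) → sumOver S (degL E) ≤ size (neighbourhood E S)
neighbourhood-size {m} {n} E S degR≤1 = begin
  sum (λ i → χ (S i) * degL E i)                 ≡⟨ sum-cong-≗ row ⟩
  sum (λ i → sum (λ j → χ (S i ∧ E i j)))        ≡⟨ ∑-comm (λ i j → χ (S i ∧ E i j)) ⟩
  sum (λ j → sum (λ i → χ (S i ∧ E i j)))        ≤⟨ sum-mono column ⟩
  size (neighbourhood E S)                       ∎
  where
  open ≤-Reasoning
  row : ∀ i → χ (S i) * degL E i ≡ sum (λ j → χ (S i ∧ E i j))
  row i rewrite countTrue-tabulate (E i) with S i
  ... | true  = +-identityʳ (size (E i))
  ... | false = sym (sum-replicate-zero n)
  χ-∧ : ∀ a b → χ (a ∧ b) ≤ χ b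
  χ-∧ true  b = ≤-refl
  χ-∧ false b = z≤n
  column : ∀ j → sum (λ i → χ (S i ∧ E i j)) ≤ χ (neighbourhood E S j)
  column j = size≤1⇒≤some (λ i → S i ∧ E i j)
    (≤-trans (sum-mono (λ i → χ-∧ (S i) (E i j)))
             (subst (_≤ 1) (countTrue-tabulate (λ i → E i j)) (degR≤1 j)))

lemma6 : ∀ {m n : ℕ} (E : BipGraph m n) (w : ℕ) →
    RightDegOne E →
    Σ (Vec Bool m → Vec Bool n) (IsDominatingInjection E w) →
    (t : ℕ → ℕ) →
    (∀ k → 1 ≤ k → k ≤ maxDegL E → t k ≤ degDist E k) →
    2 ^ m ≤ 2 ^ sum1 (maxDegL E) t
    * ballSize (n ∸ sum1 (maxDegL E) (λ k → k * t k)) w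
lemma6 {m} {n} E w degR≡1 (φ , injective , weight , dominated) t t≤d
  with degree-layers (degL E) t (maxDegL E)
         (λ k 1≤k k≤Δ → subst (t k ≤_) (countTrue-tabulate (level (degL E) k)) (t≤d k 1≤k k≤Δ))
... | S , _ , |S| , degS = begin
  2 ^ m                                      ≤⟨ restriction-bound S N w φ injective
                                                   (λ x → neighbourhood-vanishes E S x (φ x) (dominated x))
                                                   weight ⟩
  2 ^ size S * ballSize (size (not ∘ N)) w   ≡⟨ cong₂ (λ a c → 2 ^ a * ballSize c w) |S| free≡ ⟩
  2 ^ T * ballSize (n ∸ size N) w            ≤⟨ *-monoʳ-≤ (2 ^ T) (ballSize-mono w (∸-monoʳ-≤ n s≤|N|)) ⟩
  2 ^ T * ballSize (n ∸ s) w                 ∎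
  where
  open ≤-Reasoning
  T = sum1 (maxDegL E) t
  s = sum1 (maxDegL E) (λ k → k * t k)
  N = neighbourhood E S
  free≡ : size (not ∘ N) ≡ n ∸ size N
  free≡ = trans (sym (m+n∸n≡m (size (not ∘ N)) (size N))) (cong (_∸ size N) (size-complement N))
  s≤|N| : s ≤ size N
  s≤|N| = subst (_≤ size N) degS (neighbourhood-size E S (≤-reflexive ∘ degR≡1))
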